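{- For every integer $n\ge 1$, $$\det\left(\begin{bmatrix} 2i\\ i-j\end{bmatrix}x^2+\begin{bmatrix} 2i+2\\ i+1-j\end{bmatrix}\right)_{i,j=0}^{n-1}=Luc_{2n}(x),$$ and for every integer $n\ge 0$, $$x\det\left(\begin{bmatrix} 2i+1\\ i-j\end{bmatrix}x^2+\begin{bmatrix} 2i+3\\ i+1-j\end{bmatrix}\right)_{i,j=0}^{n-1}=Luc_{2n+1}(x).$$
   Context: For integers $a\ge 0$ and $m$, the $q$-binomial coefficient is $\begin{bmatrix} a\\ m\end{bmatrix}=\frac{(1-q^a)(1-q^{a-1})\cdots(1-q^{a-m+1})}{(1-q)(1-q^2)\cdots(1-q^m)}$ for $0\le m\le a$ and $0$ otherwise. Let $[m]=\frac{1-q^m}{1-q}$. For $N\ge 1$, $Luc_N(x)=\sum_{k=0}^{\lfloor N/2\rfloor}q^{\binom{k}{2}}\begin{bmatrix} N-k\\ k\end{bmatrix}\frac{[N]}{[N-k]}x^{N-2k}$. The determinant of a $0\times0$ matrix is $1$. -}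

module Defs where

open import Data.Nat as ℕ using (ℕ; zero; suc; _∸_; _≤?_)
open import Data.Nat.Combinatorics using (_C_)
open import Data.Integer as ℤ using (ℤ; +_; -[1+_])
open import Data.Fin using (Fin; zero; suc; toℕ; punchIn)
open import Data.Rational as ℚ using (ℚ; 0ℚ; 1ℚ; _+_; _*_; _-_; -_; _÷_)
open import Data.Rational.Properties using (_≟_)
open import Relation.Nullary using (yes; no)

infixr 8 _^_
_^_ : ℚ → ℕ → ℚ
p ^ zero  = 1ℚ
p ^ suc n = p * p ^ n

-- division, total: returns 0 when the divisor is 0 (never used with a zero
-- divisor under the hypotheses of the theorem)
_/'_ : ℚ → ℚ → ℚ
p /' r with r ≟ 0ℚ
... | yes _  = 0ℚ
... | no r≢0 = _÷_ p r {{ℚ.≢-nonZero r≢0}}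

sumTo : ℕ → (ℕ → ℚ) → ℚ
sumTo zero    f = 0ℚ
sumTo (suc n) f = sumTo n f + f n

sumFin : (n : ℕ) → (Fin n → ℚ) → ℚ
sumFin zero    f = 0ℚ
sumFin (suc n) f = f zero + sumFin n (λ j → f (suc j))

numProd : ℚ → ℕ → ℕ → ℚ
numProd q a zero    = 1ℚ
numProd q a (suc m) = (1ℚ - q ^ (a ∸ m)) * numProd q a m

denProd : ℚ → ℕ → ℚ
denProd q zero    = 1ℚ
denProd q (suc m) = (1ℚ - q ^ suc m) * denProd q m

qbinom : ℚ → ℕ → ℤ → ℚ
qbinom q a -[1+ _ ] = 0ℚ
qbinom q a (+ m) with m ≤? a
... | yes _ = numProd q a m /' denProd q m
... | no  _ = 0ℚ

qint : ℚ → ℕ → ℚ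
qint q m = (1ℚ - q ^ m) /' (1ℚ - q)

Luc : ℚ → ℕ → ℚ → ℚ
Luc q N x = sumTo (suc (N ℕ./ 2)) λ k →
  q ^ (k C 2) * qbinom q (N ∸ k) (+ k) * (qint q N /' qint q (N ∸ k))
    * x ^ (N ∸ (2 ℕ.* k))

det : (n : ℕ) → (Fin n → Fin n → ℚ) → ℚ
det zero    A = 1ℚ
det (suc n) A = sumFin (suc n) λ j →
  (- 1ℚ) ^ toℕ j * A zero j * det n (λ i k → A (suc i) (punchIn j k))

_⊖'_ : ℕ → ℕ → ℤ
i ⊖' j = + i ℤ.- + j

Meven : ℚ → ℚ → (n : ℕ) → Fin n → Fin n → ℚ
Meven q x n i j = qbinom q (2 ℕ.* toℕ i) (toℕ i ⊖' toℕ j) * x ^ 2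
                + qbinom q (2 ℕ.* toℕ i ℕ.+ 2) (suc (toℕ i) ⊖' toℕ j)

Modd : ℚ → ℚ → (n : ℕ) → Fin n → Fin n → ℚ
Modd q x n i j = qbinom q (2 ℕ.* toℕ i ℕ.+ 1) (toℕ i ⊖' toℕ j) * x ^ 2
               + qbinom q (2 ℕ.* toℕ i ℕ.+ 3) (suc (toℕ i) ⊖' toℕ j)

{-# OPTIONS --safe #-}
-- Both matrices are lower Hessenberg with ones on the superdiagonal, so expanding along the last row
-- gives D(n+1) = Σ_k (-1)^(n-k) a(n,k) D(k) for their leading principal minors D. After reversing the
-- sum this is the recurrence Luc(M+2) = Σ_j (-1)^j ([M+2, j+1] + x² [M, j]) Luc(M-2j), M = 2n or 2n+1
-- (with Luc(0) = 1), which is the difference of two instances of the inversion formula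
-- Σ_j (-1)^j [N, j] Luc(N-2j) = x^N. Inserting the definition of Luc into the inversion formula and
-- exchanging the sums, it reduces to the vanishing of the inner sums Σ_j (-1)^j [N, j] c(N-2j, m-j)
-- for 1 ≤ m ≤ N/2, where c are the coefficients of Luc; these sums telescope by a Gosper certificate.
module Submission where

module Proof where
  open import Defs
  open import Data.Nat as ℕ using (ℕ; zero; suc; _≤_; _<_; z≤n; s≤s; _∸_; ⌊_/2⌋)
  import Data.Nat.Properties as ℕP
  import Data.Nat.DivMod as ℕD
  import Data.Nat.Tactic.RingSolver as ℕSolver
  open import Data.Rational using (ℚ; 0ℚ; 1ℚ; _+_; _*_; _-_; -_; 1/_; NonZero; ≢-nonZero)
  import Data.Rational.Properties as ℚP
  open import Data.Fin using (Fin; zero; suc; toℕ; punchIn)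
  open import Data.Maybe using (Maybe; just; nothing)
  open import Data.Sum using (inj₁; inj₂)
  import Data.Integer as ℤ
  import Data.Integer.Properties as ℤP
  open import Data.Nat.Combinatorics using (_C_; nCk+nC[k+1]≡[n+1]C[k+1]; nC1≡n)
  open import Data.Nat.Induction using (<-rec)
  open import Data.Empty using (⊥-elim)
  open import Level using (0ℓ)
  open import Relation.Binary.PropositionalEquality hiding ([_])
  open import Relation.Nullary using (yes; no)
  import Tactic.RingSolver.Core.AlmostCommutativeRing as ACR
  open import Tactic.RingSolver using (solve-∀)
  open ≡-Reasoning

  ℚ-ring : ACR.AlmostCommutativeRing 0ℓ 0ℓ
  ℚ-ring = ACR.fromCommutativeRing ℚP.+-*-commutativeRing isZero
    where
    isZero : (p : ℚ) → Maybe (0ℚ ≡ p)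
    isZero p with 0ℚ ℚP.≟ p
    ... | yes 0≡p = just 0≡p
    ... | no _    = nothing

  ^-distribˡ-+-* : ∀ p m n → p ^ (m ℕ.+ n) ≡ p ^ m * p ^ n
  ^-distribˡ-+-* p zero    n = sym (ℚP.*-identityˡ (p ^ n))
  ^-distribˡ-+-* p (suc m) n = trans (cong (p *_) (^-distribˡ-+-* p m n)) (sym (ℚP.*-assoc p (p ^ m) (p ^ n)))

  *-cancelʳ : ∀ {a b c} → a ≢ 0ℚ → b * a ≡ c * a → b ≡ c
  *-cancelʳ {a} {b} {c} a≢0 ba≡ca = begin
    b              ≡⟨ divide b ⟨
    b * a * 1/ a   ≡⟨ cong (_* 1/ a) ba≡ca ⟩
    c * a * 1/ a   ≡⟨ divide c ⟩
    c              ∎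
    where
    instance
      a-nonZero : NonZero a
      a-nonZero = ≢-nonZero a≢0
    divide : ∀ p → p * a * 1/ a ≡ p
    divide p = trans (ℚP.*-assoc p a (1/ a)) (trans (cong (p *_) (ℚP.*-inverseʳ a)) (ℚP.*-identityʳ p))

  *-≢0 : ∀ {a b} → a ≢ 0ℚ → b ≢ 0ℚ → a * b ≢ 0ℚ
  *-≢0 {a} {b} a≢0 b≢0 ab≡0 = b≢0 (*-cancelʳ a≢0 (begin
    b * a   ≡⟨ ℚP.*-comm b a ⟩
    a * b   ≡⟨ ab≡0 ⟩
    0ℚ      ≡⟨ ℚP.*-zeroˡ a ⟨
    0ℚ * a  ∎))

  /'-inverseʳ : ∀ p {r} → r ≢ 0ℚ → (p /' r) * r ≡ p
  /'-inverseʳ p {r} r≢0 with r ℚP.≟ 0ℚ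
  ... | yes r≡0 = ⊥-elim (r≢0 r≡0)
  ... | no r≢0′ = begin
    p * 1/ r * r    ≡⟨ ℚP.*-assoc p (1/ r) r ⟩
    p * (1/ r * r)  ≡⟨ cong (p *_) (ℚP.*-inverseˡ r) ⟩
    p * 1ℚ          ≡⟨ ℚP.*-identityʳ p ⟩
    p               ∎
    where
    instance
      r-nonZero : NonZero r
      r-nonZero = ≢-nonZero r≢0′

  /'-unique : ∀ {p r s} → r ≢ 0ℚ → p ≡ s * r → p /' r ≡ s
  /'-unique {p} r≢0 p≡sr = *-cancelʳ r≢0 (trans (/'-inverseʳ p r≢0) p≡sr)

  sumTo-cong : ∀ n {f g : ℕ → ℚ} → (∀ i → i < n → f i ≡ g i) → sumTo n f ≡ sumTo n g
  sumTo-cong zero    f≗g = refl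
  sumTo-cong (suc n) f≗g =
    cong₂ _+_ (sumTo-cong n (λ i i<n → f≗g i (ℕP.m<n⇒m<1+n i<n))) (f≗g n ℕP.≤-refl)

  sumTo-zero : ∀ n {f : ℕ → ℚ} → (∀ i → i < n → f i ≡ 0ℚ) → sumTo n f ≡ 0ℚ
  sumTo-zero zero    f≗0 = refl
  sumTo-zero (suc n) f≗0 = cong₂ _+_ (sumTo-zero n (λ i i<n → f≗0 i (ℕP.m<n⇒m<1+n i<n))) (f≗0 n ℕP.≤-refl)

  sumTo-+ : ∀ n (f g : ℕ → ℚ) → sumTo n (λ i → f i + g i) ≡ sumTo n f + sumTo n g
  sumTo-+ zero    f g = refl
  sumTo-+ (suc n) f g = begin
    sumTo n (λ i → f i + g i) + (f n + g n)  ≡⟨ cong (_+ (f n + g n)) (sumTo-+ n f g) ⟩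
    sumTo n f + sumTo n g + (f n + g n)      ≡⟨ interchange (sumTo n f) (sumTo n g) (f n) (g n) ⟩
    sumTo n f + f n + (sumTo n g + g n)      ∎
    where
    interchange : ∀ a b c d → a + b + (c + d) ≡ a + c + (b + d)
    interchange = solve-∀ ℚ-ring

  *-distribˡ-sumTo : ∀ n c (f : ℕ → ℚ) → c * sumTo n f ≡ sumTo n (λ i → c * f i)
  *-distribˡ-sumTo zero    c f = ℚP.*-zeroʳ c
  *-distribˡ-sumTo (suc n) c f =
    trans (ℚP.*-distribˡ-+ c (sumTo n f) (f n)) (cong (_+ c * f n) (*-distribˡ-sumTo n c f))

  *-distribʳ-sumTo : ∀ n c (f : ℕ → ℚ) → sumTo n f * c ≡ sumTo n (λ i → f i * c)
  *-distribʳ-sumTo n c f = begin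
    sumTo n f * c               ≡⟨ ℚP.*-comm (sumTo n f) c ⟩
    c * sumTo n f               ≡⟨ *-distribˡ-sumTo n c f ⟩
    sumTo n (λ i → c * f i)     ≡⟨ sumTo-cong n (λ i _ → ℚP.*-comm c (f i)) ⟩
    sumTo n (λ i → f i * c)     ∎

  sumTo-linear : ∀ n c d (f g : ℕ → ℚ) →
    sumTo n (λ i → c * f i + d * g i) ≡ c * sumTo n f + d * sumTo n g
  sumTo-linear zero    c d f g = vanish c d
    where
    vanish : ∀ c d → 0ℚ ≡ c * 0ℚ + d * 0ℚ
    vanish = solve-∀ ℚ-ring
  sumTo-linear (suc n) c d f g = begin
    sumTo n (λ i → c * f i + d * g i) + (c * f n + d * g n)  ≡⟨ cong (_+ (c * f n + d * g n)) (sumTo-linear n c d f g) ⟩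
    c * sumTo n f + d * sumTo n g + (c * f n + d * g n)      ≡⟨ regroup c d (sumTo n f) (sumTo n g) (f n) (g n) ⟩
    c * (sumTo n f + f n) + d * (sumTo n g + g n)            ∎
    where
    regroup : ∀ c d F G a b → c * F + d * G + (c * a + d * b) ≡ c * (F + a) + d * (G + b)
    regroup = solve-∀ ℚ-ring

  sumTo-head : ∀ n (f : ℕ → ℚ) → sumTo (suc n) f ≡ f 0 + sumTo n (λ i → f (suc i))
  sumTo-head zero    f = trans (ℚP.+-identityˡ (f 0)) (sym (ℚP.+-identityʳ (f 0)))
  sumTo-head (suc n) f = begin
    sumTo (suc n) f + f (suc n)                    ≡⟨ cong (_+ f (suc n)) (sumTo-head n f) ⟩
    f 0 + sumTo n (λ i → f (suc i)) + f (suc n)    ≡⟨ ℚP.+-assoc (f 0) _ _ ⟩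
    f 0 + (sumTo n (λ i → f (suc i)) + f (suc n))  ∎

  sumTo-telescope : ∀ n (h : ℕ → ℚ) → sumTo n (λ j → h (suc j) - h j) ≡ h n - h 0
  sumTo-telescope zero    h = sym (ℚP.+-inverseʳ (h 0))
  sumTo-telescope (suc n) h = begin
    sumTo n (λ j → h (suc j) - h j) + (h (suc n) - h n)  ≡⟨ cong (_+ (h (suc n) - h n)) (sumTo-telescope n h) ⟩
    h n - h 0 + (h (suc n) - h n)                        ≡⟨ cancel (h n) (h 0) (h (suc n)) ⟩
    h (suc n) - h 0                                      ∎
    where
    cancel : ∀ a b c → a - b + (c - a) ≡ c - b
    cancel = solve-∀ ℚ-ring

  sumTo-reverse : ∀ n (f : ℕ → ℚ) → sumTo (suc n) f ≡ sumTo (suc n) (λ j → f (n ∸ j))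
  sumTo-reverse zero    f = refl
  sumTo-reverse (suc n) f = begin
    sumTo (suc n) f + f (suc n)                        ≡⟨ cong (_+ f (suc n)) (sumTo-reverse n f) ⟩
    sumTo (suc n) (λ j → f (n ∸ j)) + f (suc n)        ≡⟨ ℚP.+-comm _ (f (suc n)) ⟩
    f (suc n) + sumTo (suc n) (λ j → f (n ∸ j))        ≡⟨ sumTo-head (suc n) (λ j → f (suc n ∸ j)) ⟨
    sumTo (suc (suc n)) (λ j → f (suc n ∸ j))          ∎

  sumTo-triangle : ∀ n (h : ℕ → ℕ → ℚ) →
    sumTo (suc n) (λ t → sumTo (suc (n ∸ t)) (λ k → h t (t ℕ.+ k)))
    ≡ sumTo (suc n) (λ m → sumTo (suc m) (λ t → h t m))
  sumTo-triangle zero    h = refl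
  sumTo-triangle (suc n) h = begin
    sumTo (suc n) (λ t → row (suc n) t) + row (suc n) (suc n)
      ≡⟨ cong₂ _+_ (sumTo-cong (suc n) extend) lastRow ⟩
    sumTo (suc n) (λ t → row n t + h t (suc n)) + h (suc n) (suc n)
      ≡⟨ cong (_+ h (suc n) (suc n)) (sumTo-+ (suc n) (row n) (λ t → h t (suc n))) ⟩
    sumTo (suc n) (row n) + sumTo (suc n) (λ t → h t (suc n)) + h (suc n) (suc n)
      ≡⟨ cong (λ s → s + sumTo (suc n) (λ t → h t (suc n)) + h (suc n) (suc n)) (sumTo-triangle n h) ⟩
    sumTo (suc n) (λ m → sumTo (suc m) (λ t → h t m)) + sumTo (suc n) (λ t → h t (suc n)) + h (suc n) (suc n)
      ≡⟨ ℚP.+-assoc (sumTo (suc n) (λ m → sumTo (suc m) (λ t → h t m))) _ _ ⟩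
    sumTo (suc n) (λ m → sumTo (suc m) (λ t → h t m)) + sumTo (suc (suc n)) (λ t → h t (suc n))
      ∎
    where
    row : ℕ → ℕ → ℚ
    row n t = sumTo (suc (n ∸ t)) (λ k → h t (t ℕ.+ k))
    extend : ∀ t → t < suc n → row (suc n) t ≡ row n t + h t (suc n)
    extend t (s≤s t≤n) rewrite ℕP.+-∸-assoc 1 t≤n =
      cong (λ m → row n t + h t m) (trans (ℕP.+-suc t (n ∸ t)) (cong suc (ℕP.m+[n∸m]≡n t≤n)))
    lastRow : row (suc n) (suc n) ≡ h (suc n) (suc n)
    lastRow rewrite ℕP.n∸n≡0 n | ℕP.+-identityʳ n = ℚP.+-identityˡ (h (suc n) (suc n))

  -- Leading minors of unit lower Hessenberg matrices

  sumFin-cong : ∀ n {f g : Fin n → ℚ} → (∀ j → f j ≡ g j) → sumFin n f ≡ sumFin n g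
  sumFin-cong zero    f≗g = refl
  sumFin-cong (suc n) f≗g = cong₂ _+_ (f≗g zero) (sumFin-cong n (λ j → f≗g (suc j)))

  sumFin-zero : ∀ n {f : Fin n → ℚ} → (∀ j → f j ≡ 0ℚ) → sumFin n f ≡ 0ℚ
  sumFin-zero zero    f≗0 = refl
  sumFin-zero (suc n) f≗0 = cong₂ _+_ (f≗0 zero) (sumFin-zero n (λ j → f≗0 (suc j)))

  det-cong : ∀ n {A B : Fin n → Fin n → ℚ} → (∀ i j → A i j ≡ B i j) → det n A ≡ det n B
  det-cong zero    A≗B = refl
  det-cong (suc n) A≗B = sumFin-cong (suc n) λ j →
    cong₂ (λ a d → (- 1ℚ) ^ toℕ j * a * d) (A≗B zero j) (det-cong n (λ i k → A≗B (suc i) (punchIn j k)))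

  Matrix : Set
  Matrix = ℕ → ℕ → ℚ

  leadingMinor : Matrix → ℕ → ℚ
  leadingMinor a n = det n (λ i j → a (toℕ i) (toℕ j))

  record IsUnitHessenberg (a : Matrix) : Set where
    field
      above-superdiagonal : ∀ i j → suc i < j → a i j ≡ 0ℚ
      superdiagonal       : ∀ i → a i (suc i) ≡ 1ℚ

  minor₀₀ : Matrix → Matrix
  minor₀₀ a i j = a (suc i) (suc j)

  minor₀₁ : Matrix → Matrix
  minor₀₁ a i zero    = a (suc i) zero
  minor₀₁ a i (suc j) = a (suc i) (suc (suc j))

  module _ {a : Matrix} (H : IsUnitHessenberg a) where
    open IsUnitHessenberg H

    minor₀₀-isUnitHessenberg : IsUnitHessenberg (minor₀₀ a)
    minor₀₀-isUnitHessenberg = record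
      { above-superdiagonal = λ i j i+1<j → above-superdiagonal (suc i) (suc j) (s≤s i+1<j)
      ; superdiagonal       = λ i → superdiagonal (suc i)
      }

    minor₀₁-isUnitHessenberg : IsUnitHessenberg (minor₀₁ a)
    minor₀₁-isUnitHessenberg = record
      { above-superdiagonal = above
      ; superdiagonal       = λ i → superdiagonal (suc i)
      }
      where
      above : ∀ i j → suc i < j → minor₀₁ a i j ≡ 0ℚ
      above i (suc j) i+1<j+1 = above-superdiagonal (suc i) (suc (suc j)) (s≤s i+1<j+1)

    leadingMinor-expandRow₀ : ∀ n →
      leadingMinor a (suc (suc n))
      ≡ a 0 0 * leadingMinor (minor₀₀ a) (suc n) - leadingMinor (minor₀₁ a) (suc n)
    leadingMinor-expandRow₀ n = begin
      1ℚ * a 0 0 * D₀₀ + ((- 1ℚ) * 1ℚ * a 0 1 * D′₀₁ + sumFin n farTerm)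
        ≡⟨ cong₂ (λ u v → 1ℚ * a 0 0 * D₀₀ + ((- 1ℚ) * 1ℚ * a 0 1 * u + v))
                 (det-cong (suc n) reindex) (sumFin-zero n farTerm≡0) ⟩
      1ℚ * a 0 0 * D₀₀ + ((- 1ℚ) * 1ℚ * a 0 1 * D₀₁ + 0ℚ)
        ≡⟨ cong (λ u → 1ℚ * a 0 0 * D₀₀ + ((- 1ℚ) * 1ℚ * u * D₀₁ + 0ℚ)) (superdiagonal 0) ⟩
      1ℚ * a 0 0 * D₀₀ + ((- 1ℚ) * 1ℚ * 1ℚ * D₀₁ + 0ℚ)
        ≡⟨ simplify (a 0 0) D₀₀ D₀₁ ⟩
      a 0 0 * D₀₀ - D₀₁
        ∎
      where
      A : Fin (suc (suc n)) → Fin (suc (suc n)) → ℚ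
      A i j = a (toℕ i) (toℕ j)
      D₀₀ D₀₁ D′₀₁ : ℚ
      D₀₀  = leadingMinor (minor₀₀ a) (suc n)
      D₀₁  = leadingMinor (minor₀₁ a) (suc n)
      D′₀₁ = det (suc n) (λ i k → A (suc i) (punchIn (suc zero) k))
      reindex : ∀ i k → A (suc i) (punchIn (suc zero) k) ≡ minor₀₁ a (toℕ i) (toℕ k)
      reindex i zero    = refl
      reindex i (suc k) = refl
      sign minor farTerm : Fin n → ℚ
      sign j    = (- 1ℚ) ^ toℕ (suc (suc j))
      minor j   = det (suc n) (λ i k → A (suc i) (punchIn (suc (suc j)) k))
      farTerm j = sign j * A zero (suc (suc j)) * minor j
      farTerm≡0 : ∀ j → farTerm j ≡ 0ℚ
      farTerm≡0 j = trans (cong (λ e → sign j * e * minor j) (above-superdiagonal 0 (suc (suc (toℕ j))) (s≤s (s≤s z≤n))))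
                          (annihilate (sign j) (minor j))
        where
        annihilate : ∀ s d → s * 0ℚ * d ≡ 0ℚ
        annihilate = solve-∀ ℚ-ring
      simplify : ∀ b X Y → 1ℚ * b * X + ((- 1ℚ) * 1ℚ * 1ℚ * Y + 0ℚ) ≡ b * X - Y
      simplify = solve-∀ ℚ-ring

  leadingMinor-expandLastRow : ∀ n {a} → IsUnitHessenberg a →
    leadingMinor a (suc n) ≡ sumTo (suc n) (λ k → (- 1ℚ) ^ (n ∸ k) * a n k * leadingMinor a k)
  leadingMinor-expandLastRow zero    {a} H = simplify (a 0 0)
    where
    simplify : ∀ b → 1ℚ * b * 1ℚ + 0ℚ ≡ 0ℚ + 1ℚ * b * 1ℚ
    simplify = solve-∀ ℚ-ring
  leadingMinor-expandLastRow (suc n) {a} H = begin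
    D (suc (suc n))
      ≡⟨ leadingMinor-expandRow₀ H n ⟩
    a 0 0 * D₀₀ (suc n) - D₀₁ (suc n)
      ≡⟨ cong₂ (λ u v → a 0 0 * u - v)
               (leadingMinor-expandLastRow n (minor₀₀-isUnitHessenberg H))
               (trans (leadingMinor-expandLastRow n (minor₀₁-isUnitHessenberg H)) (sumTo-head n _)) ⟩
    a 0 0 * X - (s 0 * a (suc n) 0 * 1ℚ + Z)
      ≡⟨ regroup (s 0) (a (suc n) 0) (a 0 0) X (α 0) Z ⟩
    (- 1ℚ) ^ suc n * a (suc n) 0 * 1ℚ + (a 0 0 * X + (- 1ℚ) * (s 0 * α 0 * 0ℚ + Z))
      ≡⟨ cong (λ z → (- 1ℚ) ^ suc n * a (suc n) 0 * 1ℚ + (a 0 0 * X + (- 1ℚ) * z)) (sumTo-head n _) ⟨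
    (- 1ℚ) ^ suc n * a (suc n) 0 * 1ℚ + (a 0 0 * X + (- 1ℚ) * sumTo (suc n) (λ k → s k * α k * g k))
      ≡⟨ cong ((- 1ℚ) ^ suc n * a (suc n) 0 * 1ℚ +_) (sumTo-linear (suc n) (a 0 0) (- 1ℚ) _ _) ⟨
    (- 1ℚ) ^ suc n * a (suc n) 0 * 1ℚ + sumTo (suc n) (λ k → a 0 0 * (s k * α k * D₀₀ k) + (- 1ℚ) * (s k * α k * g k))
      ≡⟨ cong ((- 1ℚ) ^ suc n * a (suc n) 0 * 1ℚ +_) (sumTo-cong (suc n) λ k _ →
           trans (distribute (s k) (α k) (a 0 0) (D₀₀ k) (g k)) (cong (s k * α k *_) (sym (D-suc k)))) ⟩
    (- 1ℚ) ^ suc n * a (suc n) 0 * 1ℚ + sumTo (suc n) (λ k → s k * α k * D (suc k))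
      ≡⟨ sumTo-head (suc n) _ ⟨
    sumTo (suc (suc n)) (λ k → (- 1ℚ) ^ (suc n ∸ k) * a (suc n) k * D k)
      ∎
    where
    D D₀₀ D₀₁ s α g : ℕ → ℚ
    D   = leadingMinor a
    D₀₀ = leadingMinor (minor₀₀ a)
    D₀₁ = leadingMinor (minor₀₁ a)
    s k = (- 1ℚ) ^ (n ∸ k)
    α k = a (suc n) (suc k)
    g zero    = 0ℚ
    g (suc k) = D₀₁ (suc k)
    X Z : ℚ
    X = sumTo (suc n) (λ k → s k * α k * D₀₀ k)
    Z = sumTo n (λ k → s (suc k) * α (suc k) * D₀₁ (suc k))
    -- expandRow₀ needs size ≥ 2: at size 1 the minor₀₁ term must count as 0, not as the empty determinant 1
    D-suc : ∀ k → D (suc k) ≡ a 0 0 * D₀₀ k - g k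
    D-suc zero    = simplify (a 0 0)
      where
      simplify : ∀ b → 1ℚ * b * 1ℚ + 0ℚ ≡ b * 1ℚ - 0ℚ
      simplify = solve-∀ ℚ-ring
    D-suc (suc k) = leadingMinor-expandRow₀ H k
    regroup : ∀ σ b c X α Z → c * X - (σ * b * 1ℚ + Z) ≡ (- 1ℚ) * σ * b * 1ℚ + (c * X + (- 1ℚ) * (σ * α * 0ℚ + Z))
    regroup = solve-∀ ℚ-ring
    distribute : ∀ σ α c d e → c * (σ * α * d) + (- 1ℚ) * (σ * α * e) ≡ σ * α * (c * d - e)
    distribute = solve-∀ ℚ-ring

  2*suc : ∀ n → 2 ℕ.* suc n ≡ suc (suc (2 ℕ.* n))
  2*suc n = cong suc (ℕP.+-suc n (n ℕ.+ 0))

  n/2≡⌊n/2⌋ : ∀ n → n ℕ./ 2 ≡ ⌊ n /2⌋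
  n/2≡⌊n/2⌋ zero          = refl
  n/2≡⌊n/2⌋ (suc zero)    = refl
  n/2≡⌊n/2⌋ (suc (suc n)) = trans (ℕD.m/n≡1+[m∸n]/n {suc (suc n)} {2} (s≤s (s≤s z≤n))) (cong suc (n/2≡⌊n/2⌋ n))

  k≤⌊n/2⌋⇒2k≤n : ∀ {k} n → k ≤ ⌊ n /2⌋ → 2 ℕ.* k ≤ n
  k≤⌊n/2⌋⇒2k≤n {zero}  n             _         = z≤n
  k≤⌊n/2⌋⇒2k≤n {suc k} (suc (suc n)) (s≤s k≤) rewrite 2*suc k = s≤s (s≤s (k≤⌊n/2⌋⇒2k≤n n k≤))

  ⌊[n∸2j]/2⌋≡⌊n/2⌋∸j : ∀ n j → ⌊ n ∸ 2 ℕ.* j /2⌋ ≡ ⌊ n /2⌋ ∸ j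
  ⌊[n∸2j]/2⌋≡⌊n/2⌋∸j n             zero    = refl
  ⌊[n∸2j]/2⌋≡⌊n/2⌋∸j n             (suc j) rewrite 2*suc j with n
  ... | zero          = refl
  ... | suc zero      = refl
  ... | suc (suc n′)  = ⌊[n∸2j]/2⌋≡⌊n/2⌋∸j n′ j

  ⌊[2n+e]/2⌋≡n : ∀ n {e} → e ≤ 1 → ⌊ 2 ℕ.* n ℕ.+ e /2⌋ ≡ n
  ⌊[2n+e]/2⌋≡n zero    z≤n       = refl
  ⌊[2n+e]/2⌋≡n zero    (s≤s z≤n) = refl
  ⌊[2n+e]/2⌋≡n (suc n) e≤1 rewrite ℕP.+-suc n (n ℕ.+ 0) = cong suc (⌊[2n+e]/2⌋≡n n e≤1)

  -- q-integers and q-binomial coefficients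

  triangular : ℕ → ℕ
  triangular zero    = zero
  triangular (suc k) = triangular k ℕ.+ k

  kC2≡triangular : ∀ k → k C 2 ≡ triangular k
  kC2≡triangular zero    = refl
  kC2≡triangular (suc k) = begin
    suc k C 2          ≡⟨ nCk+nC[k+1]≡[n+1]C[k+1] k 1 ⟨
    k C 1 ℕ.+ k C 2    ≡⟨ cong₂ ℕ._+_ (nC1≡n k) (kC2≡triangular k) ⟩
    k ℕ.+ triangular k ≡⟨ ℕP.+-comm k (triangular k) ⟩
    triangular (suc k) ∎

  module _ (q : ℚ) where

    [_] : ℕ → ℚ
    [ zero  ] = 0ℚ
    [ suc n ] = 1ℚ + q * [ n ]

    [m+n]≡[m]+q^m[n] : ∀ m n → [ m ℕ.+ n ] ≡ [ m ] + q ^ m * [ n ]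
    [m+n]≡[m]+q^m[n] zero    n = sym (trans (ℚP.+-identityˡ _) (ℚP.*-identityˡ [ n ]))
    [m+n]≡[m]+q^m[n] (suc m) n = begin
      1ℚ + q * [ m ℕ.+ n ]                ≡⟨ cong (λ z → 1ℚ + q * z) ([m+n]≡[m]+q^m[n] m n) ⟩
      1ℚ + q * ([ m ] + q ^ m * [ n ])    ≡⟨ expand q [ m ] (q ^ m) [ n ] ⟩
      1ℚ + q * [ m ] + q * q ^ m * [ n ]  ∎
      where
      expand : ∀ q a b c → 1ℚ + q * (a + b * c) ≡ 1ℚ + q * a + q * b * c
      expand = solve-∀ ℚ-ring

    [1-q][n]≡1-q^n : ∀ n → (1ℚ - q) * [ n ] ≡ 1ℚ - q ^ n
    [1-q][n]≡1-q^n zero    = trans (ℚP.*-zeroʳ (1ℚ - q)) (sym (ℚP.+-inverseʳ 1ℚ))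
    [1-q][n]≡1-q^n (suc n) = begin
      (1ℚ - q) * (1ℚ + q * [ n ])        ≡⟨ expand q [ n ] ⟩
      1ℚ - q + q * ((1ℚ - q) * [ n ])    ≡⟨ cong (λ z → 1ℚ - q + q * z) ([1-q][n]≡1-q^n n) ⟩
      1ℚ - q + q * (1ℚ - q ^ n)          ≡⟨ collapse q (q ^ n) ⟩
      1ℚ - q * q ^ n                     ∎
      where
      expand : ∀ q a → (1ℚ - q) * (1ℚ + q * a) ≡ 1ℚ - q + q * ((1ℚ - q) * a)
      expand = solve-∀ ℚ-ring
      collapse : ∀ q b → 1ℚ - q + q * (1ℚ - b) ≡ 1ℚ - q * b
      collapse = solve-∀ ℚ-ring

    _choose_ : ℕ → ℕ → ℚ
    n     choose zero  = 1ℚ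
    zero  choose suc k = 0ℚ
    suc n choose suc k = n choose k + q ^ suc k * (n choose suc k)

    numProd-over : ∀ n k → n < k → numProd q n k ≡ 0ℚ
    numProd-over n (suc k) (s≤s n≤k) with ℕP.m≤n⇒m<n∨m≡n n≤k
    ... | inj₁ n<k  = trans (cong ((1ℚ - q ^ (n ∸ k)) *_) (numProd-over n k n<k)) (ℚP.*-zeroʳ (1ℚ - q ^ (n ∸ k)))
    ... | inj₂ refl = begin
      (1ℚ - q ^ (n ∸ n)) * numProd q n n  ≡⟨ cong (λ e → (1ℚ - q ^ e) * numProd q n n) (ℕP.n∸n≡0 n) ⟩
      (1ℚ - 1ℚ) * numProd q n n           ≡⟨ ℚP.*-zeroˡ (numProd q n n) ⟩
      0ℚ                                  ∎

    numProd-suc : ∀ n k → numProd q (suc n) (suc k) ≡ (1ℚ - q ^ suc n) * numProd q n k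
    numProd-suc n zero    = refl
    numProd-suc n (suc k) = begin
      (1ℚ - q ^ (n ∸ k)) * numProd q (suc n) (suc k)            ≡⟨ cong ((1ℚ - q ^ (n ∸ k)) *_) (numProd-suc n k) ⟩
      (1ℚ - q ^ (n ∸ k)) * ((1ℚ - q ^ suc n) * numProd q n k)   ≡⟨ swap (1ℚ - q ^ (n ∸ k)) (1ℚ - q ^ suc n) _ ⟩
      (1ℚ - q ^ suc n) * ((1ℚ - q ^ (n ∸ k)) * numProd q n k)   ∎
      where
      swap : ∀ a b c → a * (b * c) ≡ b * (a * c)
      swap = solve-∀ ℚ-ring

    choose*denProd≡numProd : ∀ n k → (n choose k) * denProd q k ≡ numProd q n k
    choose*denProd≡numProd n       zero    = refl
    choose*denProd≡numProd zero    (suc k) = trans (ℚP.*-zeroˡ (denProd q (suc k))) (sym (numProd-over 0 (suc k) (s≤s z≤n)))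
    choose*denProd≡numProd (suc n) (suc k) = begin
      (n choose k + q ^ suc k * (n choose suc k)) * ((1ℚ - q ^ suc k) * denProd q k)
        ≡⟨ expand (n choose k) (q ^ suc k) (n choose suc k) (denProd q k) ⟩
      (1ℚ - q ^ suc k) * ((n choose k) * denProd q k) + q ^ suc k * ((n choose suc k) * denProd q (suc k))
        ≡⟨ cong₂ (λ u v → (1ℚ - q ^ suc k) * u + q ^ suc k * v) (choose*denProd≡numProd n k) (choose*denProd≡numProd n (suc k)) ⟩
      (1ℚ - q ^ suc k) * numProd q n k + q ^ suc k * ((1ℚ - q ^ (n ∸ k)) * numProd q n k)
        ≡⟨ collect (q ^ suc k) (q ^ (n ∸ k)) (numProd q n k) ⟩
      (1ℚ - q ^ suc k * q ^ (n ∸ k)) * numProd q n k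
        ≡⟨ exponents ⟩
      (1ℚ - q ^ suc n) * numProd q n k
        ≡⟨ numProd-suc n k ⟨
      numProd q (suc n) (suc k)
        ∎
      where
      expand : ∀ u Q v d → (u + Q * v) * ((1ℚ - Q) * d) ≡ (1ℚ - Q) * (u * d) + Q * (v * ((1ℚ - Q) * d))
      expand = solve-∀ ℚ-ring
      collect : ∀ Q R p → (1ℚ - Q) * p + Q * ((1ℚ - R) * p) ≡ (1ℚ - Q * R) * p
      collect = solve-∀ ℚ-ring
      exponents : (1ℚ - q ^ suc k * q ^ (n ∸ k)) * numProd q n k ≡ (1ℚ - q ^ suc n) * numProd q n k
      exponents with k ℕ.≤? n
      ... | yes k≤n = cong (λ z → (1ℚ - z) * numProd q n k)
                        (trans (sym (^-distribˡ-+-* q (suc k) (n ∸ k))) (cong (λ e → q ^ suc e) (ℕP.m+[n∸m]≡n k≤n)))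
      ... | no  k≰n = trans (vanish (1ℚ - q ^ suc k * q ^ (n ∸ k))) (sym (vanish (1ℚ - q ^ suc n)))
        where
        vanish : ∀ c → c * numProd q n k ≡ 0ℚ
        vanish c = trans (cong (c *_) (numProd-over n k (ℕP.≰⇒> k≰n))) (ℚP.*-zeroʳ c)

    choose-over : ∀ n k → n < k → n choose k ≡ 0ℚ
    choose-over zero    (suc k) _         = refl
    choose-over (suc n) (suc k) (s≤s n<k) = begin
      n choose k + q ^ suc k * (n choose suc k)  ≡⟨ cong₂ (λ u v → u + q ^ suc k * v) (choose-over n k n<k) (choose-over n (suc k) (ℕP.m<n⇒m<1+n n<k)) ⟩
      0ℚ + q ^ suc k * 0ℚ                        ≡⟨ cong (0ℚ +_) (ℚP.*-zeroʳ (q ^ suc k)) ⟩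
      0ℚ                                         ∎

    module _ (q^m≢1 : ∀ m → 1 ≤ m → 1ℚ - q ^ m ≢ 0ℚ) where

      1-q≢0 : 1ℚ - q ≢ 0ℚ
      1-q≢0 1-q≡0 = q^m≢1 1 (s≤s z≤n) (trans (cong (λ p → 1ℚ - p) (ℚP.*-identityʳ q)) 1-q≡0)

      [n]≢0 : ∀ n → 1 ≤ n → [ n ] ≢ 0ℚ
      [n]≢0 n 1≤n [n]≡0 = q^m≢1 n 1≤n (begin
        1ℚ - q ^ n        ≡⟨ [1-q][n]≡1-q^n n ⟨
        (1ℚ - q) * [ n ]  ≡⟨ cong ((1ℚ - q) *_) [n]≡0 ⟩
        (1ℚ - q) * 0ℚ     ≡⟨ ℚP.*-zeroʳ (1ℚ - q) ⟩
        0ℚ                ∎)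

      denProd≢0 : ∀ k → denProd q k ≢ 0ℚ
      denProd≢0 zero    ()
      denProd≢0 (suc k) = *-≢0 (q^m≢1 (suc k) (s≤s z≤n)) (denProd≢0 k)

      qint≡[n] : ∀ n → qint q n ≡ [ n ]
      qint≡[n] n = /'-unique 1-q≢0 (trans (sym ([1-q][n]≡1-q^n n)) (ℚP.*-comm (1ℚ - q) [ n ]))

      qbinom≡choose : ∀ n k → qbinom q n (ℤ.+ k) ≡ n choose k
      qbinom≡choose n k with k ℕ.≤? n
      ... | yes _   = /'-unique (denProd≢0 k) (sym (choose*denProd≡numProd n k))
      ... | no  k≰n = sym (choose-over n k (ℕP.≰⇒> k≰n))

      [1+k]*X≡[a]*choose : ∀ n k {X} a → X * denProd q (suc k) ≡ (1ℚ - q ^ a) * numProd q n k →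
        [ suc k ] * X ≡ [ a ] * (n choose k)
      [1+k]*X≡[a]*choose n k {X} a X-product = *-cancelʳ (*-≢0 1-q≢0 (denProd≢0 (suc k))) (begin
        [ suc k ] * X * ((1ℚ - q) * denProd q (suc k))
          ≡⟨ rearrange (1ℚ - q) [ suc k ] X (1ℚ - q ^ suc k) (denProd q k) ⟩
        ((1ℚ - q) * [ suc k ]) * (X * denProd q (suc k))
          ≡⟨ cong₂ _*_ ([1-q][n]≡1-q^n (suc k)) X-product ⟩
        (1ℚ - q ^ suc k) * ((1ℚ - q ^ a) * numProd q n k)
          ≡⟨ cong (λ z → (1ℚ - q ^ suc k) * ((1ℚ - q ^ a) * z)) (choose*denProd≡numProd n k) ⟨
        (1ℚ - q ^ suc k) * ((1ℚ - q ^ a) * ((n choose k) * denProd q k))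
          ≡⟨ cong (λ z → (1ℚ - q ^ suc k) * (z * ((n choose k) * denProd q k))) ([1-q][n]≡1-q^n a) ⟨
        (1ℚ - q ^ suc k) * ((1ℚ - q) * [ a ] * ((n choose k) * denProd q k))
          ≡⟨ rearrange′ (1ℚ - q ^ suc k) (1ℚ - q) [ a ] (n choose k) (denProd q k) ⟩
        [ a ] * (n choose k) * ((1ℚ - q) * denProd q (suc k))
          ∎)
        where
        rearrange : ∀ c i x Q d → i * x * (c * (Q * d)) ≡ (c * i) * (x * (Q * d))
        rearrange = solve-∀ ℚ-ring
        rearrange′ : ∀ Q c i b d → Q * (c * i * (b * d)) ≡ i * b * (c * (Q * d))
        rearrange′ = solve-∀ ℚ-ring

      choose-absorption : ∀ n k → [ suc k ] * (suc n choose suc k) ≡ [ suc n ] * (n choose k)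
      choose-absorption n k =
        [1+k]*X≡[a]*choose n k (suc n) (trans (choose*denProd≡numProd (suc n) (suc k)) (numProd-suc n k))

      choose-suc-ratio : ∀ n k → [ suc k ] * (n choose suc k) ≡ [ n ∸ k ] * (n choose k)
      choose-suc-ratio n k = [1+k]*X≡[a]*choose n k (n ∸ k) (choose*denProd≡numProd n (suc k))

      -- Lucas polynomials

      -- q^(k C 2) [N-k choose k] [N]/[N-k] with the division carried out: since [N] = [N-k] + q^(N-k) [k]
      -- and [k] [N-k choose k] = [N-k] [N-k-1 choose k-1], the quotient is [N-k choose k] + q^(N-k) [N-k-1 choose k-1].
      lucasCoeff : ℕ → ℕ → ℚ
      lucasCoeff N zero    = 1ℚ
      lucasCoeff N (suc k) = q ^ triangular (suc k) * ((N ∸ suc k) choose suc k + q ^ (N ∸ suc k) * ((N ∸ suc k ∸ 1) choose k))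

      [m+n]*choose : ∀ n k →
        [ suc n ℕ.+ suc k ] * (suc n choose suc k) ≡ [ suc n ] * (suc n choose suc k + q ^ suc n * (n choose k))
      [m+n]*choose n k = begin
        [ suc n ℕ.+ suc k ] * B                           ≡⟨ cong (_* B) ([m+n]≡[m]+q^m[n] (suc n) (suc k)) ⟩
        ([ suc n ] + q ^ suc n * [ suc k ]) * B           ≡⟨ expand [ suc n ] (q ^ suc n) [ suc k ] B ⟩
        [ suc n ] * B + q ^ suc n * ([ suc k ] * B)       ≡⟨ cong (λ z → [ suc n ] * B + q ^ suc n * z) (choose-absorption n k) ⟩
        [ suc n ] * B + q ^ suc n * ([ suc n ] * (n choose k)) ≡⟨ collect [ suc n ] B (q ^ suc n) (n choose k) ⟩
        [ suc n ] * (B + q ^ suc n * (n choose k))        ∎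
        where
        B : ℚ
        B = suc n choose suc k
        expand : ∀ a Q b c → (a + Q * b) * c ≡ a * c + Q * (b * c)
        expand = solve-∀ ℚ-ring
        collect : ∀ a c Q d → a * c + Q * (a * d) ≡ a * (c + Q * d)
        collect = solve-∀ ℚ-ring

      lucasCoeff≡ : ∀ N k → k < N →
        q ^ (k C 2) * qbinom q (N ∸ k) (ℤ.+ k) * (qint q N /' qint q (N ∸ k)) ≡ lucasCoeff N k
      lucasCoeff≡ N k k<N rewrite kC2≡triangular k | qbinom≡choose (N ∸ k) k | qint≡[n] N | qint≡[n] (N ∸ k) =
        divided k k<N
        where
        divided : ∀ k → k < N → q ^ triangular k * ((N ∸ k) choose k) * ([ N ] /' [ N ∸ k ]) ≡ lucasCoeff N k
        divided zero    0<N = cong (1ℚ * 1ℚ *_) (/'-unique ([n]≢0 N 0<N) (sym (ℚP.*-identityˡ [ N ])))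
        divided (suc k) k<N with N ∸ suc k in N∸[1+k]≡
        ... | zero  = ⊥-elim (ℕP.<⇒≢ (ℕP.m<n⇒0<n∸m k<N) (sym N∸[1+k]≡))
        ... | suc n = trans (ℚP.*-assoc (q ^ triangular (suc k)) B _) (cong (q ^ triangular (suc k) *_) quotient)
          where
          B : ℚ
          B = suc n choose suc k
          N≡ : N ≡ suc n ℕ.+ suc k
          N≡ = trans (sym (ℕP.m∸n+n≡m (ℕP.<⇒≤ k<N))) (cong (ℕ._+ suc k) N∸[1+k]≡)
          quotient : B * ([ N ] /' [ suc n ]) ≡ B + q ^ suc n * (n choose k)
          quotient = *-cancelʳ ([n]≢0 (suc n) (s≤s z≤n)) (begin
            B * ([ N ] /' [ suc n ]) * [ suc n ]   ≡⟨ ℚP.*-assoc B _ [ suc n ] ⟩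
            B * (([ N ] /' [ suc n ]) * [ suc n ]) ≡⟨ cong (B *_) (/'-inverseʳ [ N ] ([n]≢0 (suc n) (s≤s z≤n))) ⟩
            B * [ N ]                              ≡⟨ ℚP.*-comm B [ N ] ⟩
            [ N ] * B                              ≡⟨ cong (λ m → [ m ] * B) N≡ ⟩
            [ suc n ℕ.+ suc k ] * B                ≡⟨ [m+n]*choose n k ⟩
            [ suc n ] * (B + q ^ suc n * (n choose k)) ≡⟨ ℚP.*-comm [ suc n ] _ ⟩
            (B + q ^ suc n * (n choose k)) * [ suc n ] ∎)

      inversionTerm : ℕ → ℕ → ℕ → ℚ
      inversionTerm N m j = (- 1ℚ) ^ j * (N choose j) * lucasCoeff (N ∸ 2 ℕ.* j) (m ∸ j)

      -- a Gosper certificate for the sum of inversionTerm N m over j, where N = 2m + e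
      certificate : ℕ → ℕ → ℕ → ℕ → ℚ
      certificate N m e j =
        - ((- 1ℚ) ^ j * q ^ triangular (suc (m ∸ j)) * [ j ] * (N choose j) * (((m ∸ j) ℕ.+ e) choose (m ∸ j)))

      module GosperStep (e j r : ℕ) where
        m N : ℕ
        m = j ℕ.+ suc r
        N = 2 ℕ.* m ℕ.+ e

        s P T A B Qr Qe : ℚ
        s = (- 1ℚ) ^ j
        P = N choose j
        T = q ^ triangular (suc r)
        A = suc (r ℕ.+ e) choose suc r
        B = (r ℕ.+ e) choose r
        Qr = q ^ suc r
        Qe = q ^ suc (r ℕ.+ e)

        [m]≡ : [ m ] ≡ [ suc r ] + Qr * [ j ]
        [m]≡ = trans (cong [_] (ℕP.+-comm j (suc r))) ([m+n]≡[m]+q^m[n] (suc r) j)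

        [N∸j]≡ : [ N ∸ j ] ≡ [ suc (r ℕ.+ e) ] + Qe * ([ suc r ] + Qr * [ j ])
        [N∸j]≡ = begin
          [ N ∸ j ]                                         ≡⟨ cong (λ n → [ n ∸ j ]) (split j r e) ⟩
          [ j ℕ.+ (suc (r ℕ.+ e) ℕ.+ m) ∸ j ]               ≡⟨ cong [_] (ℕP.m+n∸m≡n j _) ⟩
          [ suc (r ℕ.+ e) ℕ.+ m ]                           ≡⟨ [m+n]≡[m]+q^m[n] (suc (r ℕ.+ e)) m ⟩
          [ suc (r ℕ.+ e) ] + Qe * [ m ]                    ≡⟨ cong (λ z → [ suc (r ℕ.+ e) ] + Qe * z) [m]≡ ⟩
          [ suc (r ℕ.+ e) ] + Qe * ([ suc r ] + Qr * [ j ]) ∎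
          where
          split : ∀ j r e → 2 ℕ.* (j ℕ.+ suc r) ℕ.+ e ≡ j ℕ.+ (suc (r ℕ.+ e) ℕ.+ (j ℕ.+ suc r))
          split = ℕSolver.solve-∀

        inversionTerm≡ : inversionTerm N m j ≡ s * P * (T * (A + Qe * B))
        inversionTerm≡ = begin
          s * P * lucasCoeff (N ∸ 2 ℕ.* j) (m ∸ j)
            ≡⟨ cong₂ (λ n k → s * P * lucasCoeff n k) N∸2j≡ (ℕP.m+n∸m≡n j (suc r)) ⟩
          s * P * lucasCoeff (suc r ℕ.+ suc (r ℕ.+ e)) (suc r)
            ≡⟨ cong (λ n → s * P * (T * (n choose suc r + q ^ n * ((n ∸ 1) choose r)))) (ℕP.m+n∸m≡n (suc r) (suc (r ℕ.+ e))) ⟩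
          s * P * (T * (A + Qe * B))
            ∎
          where
          split : ∀ j r e → 2 ℕ.* (j ℕ.+ suc r) ℕ.+ e ≡ 2 ℕ.* j ℕ.+ (suc r ℕ.+ suc (r ℕ.+ e))
          split = ℕSolver.solve-∀
          N∸2j≡ : N ∸ 2 ℕ.* j ≡ suc r ℕ.+ suc (r ℕ.+ e)
          N∸2j≡ = trans (cong (_∸ 2 ℕ.* j) (split j r e)) (ℕP.m+n∸m≡n (2 ℕ.* j) _)

        certificate-difference :
          certificate N m e (suc j) - certificate N m e j
          ≡ s * T * B * ([ suc j ] * (N choose suc j)) + s * (T * Qr) * [ j ] * P * A
        certificate-difference = begin
          certificate N m e (suc j) - certificate N m e j
            ≡⟨ cong₂ (λ a b → - ((- 1ℚ) ^ suc j * q ^ triangular (suc a) * [ suc j ] * (N choose suc j) * ((a ℕ.+ e) choose a))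
                            - - (s * q ^ triangular (suc b) * [ j ] * P * ((b ℕ.+ e) choose b)))
                     m∸[1+j]≡r (ℕP.m+n∸m≡n j (suc r)) ⟩
          - ((- 1ℚ) * s * T * [ suc j ] * (N choose suc j) * B) - - (s * q ^ (triangular (suc r) ℕ.+ suc r) * [ j ] * P * A)
            ≡⟨ cong (λ z → - ((- 1ℚ) * s * T * [ suc j ] * (N choose suc j) * B) - - (s * z * [ j ] * P * A))
                    (^-distribˡ-+-* q (triangular (suc r)) (suc r)) ⟩
          - ((- 1ℚ) * s * T * [ suc j ] * (N choose suc j) * B) - - (s * (T * Qr) * [ j ] * P * A)
            ≡⟨ simplify s T [ suc j ] (N choose suc j) B (T * Qr) [ j ] P A ⟩
          s * T * B * ([ suc j ] * (N choose suc j)) + s * (T * Qr) * [ j ] * P * A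
            ∎
          where
          m∸[1+j]≡r : m ∸ suc j ≡ r
          m∸[1+j]≡r = trans (cong (_∸ suc j) (ℕP.+-suc j r)) (ℕP.m+n∸m≡n j r)
          simplify : ∀ s T i c B U j P A →
            - ((- 1ℚ) * s * T * i * c * B) - - (s * U * j * P * A) ≡ s * T * B * (i * c) + s * U * j * P * A
          simplify = solve-∀ ℚ-ring

        telescopes : [ m ] * inversionTerm N m j ≡ certificate N m e (suc j) - certificate N m e j
        telescopes = begin
          [ m ] * inversionTerm N m j
            ≡⟨ cong₂ _*_ [m]≡ inversionTerm≡ ⟩
          ([ suc r ] + Qr * [ j ]) * (s * P * (T * (A + Qe * B)))
            ≡⟨ expandˡ s P T A B Qr Qe [ suc r ] [ j ] ⟩
          s * P * T * ([ suc r ] * A) + E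
            ≡⟨ cong (λ z → s * P * T * z + E) (choose-absorption (r ℕ.+ e) r) ⟩
          s * P * T * ([ suc (r ℕ.+ e) ] * B) + E
            ≡⟨ expandʳ s P T A B Qr Qe [ suc r ] [ j ] [ suc (r ℕ.+ e) ] ⟨
          s * T * B * (([ suc (r ℕ.+ e) ] + Qe * ([ suc r ] + Qr * [ j ])) * P) + s * (T * Qr) * [ j ] * P * A
            ≡⟨ cong (λ z → s * T * B * (z * P) + s * (T * Qr) * [ j ] * P * A) [N∸j]≡ ⟨
          s * T * B * ([ N ∸ j ] * P) + s * (T * Qr) * [ j ] * P * A
            ≡⟨ cong (λ z → s * T * B * z + s * (T * Qr) * [ j ] * P * A) (choose-suc-ratio N j) ⟨
          s * T * B * ([ suc j ] * (N choose suc j)) + s * (T * Qr) * [ j ] * P * A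
            ≡⟨ certificate-difference ⟨
          certificate N m e (suc j) - certificate N m e j
            ∎
          where
          E : ℚ
          E = s * P * T * (Qr * [ j ] * A + Qe * B * ([ suc r ] + Qr * [ j ]))
          expandˡ : ∀ s P T A B Qr Qe a i →
            (a + Qr * i) * (s * P * (T * (A + Qe * B)))
            ≡ s * P * T * (a * A) + s * P * T * (Qr * i * A + Qe * B * (a + Qr * i))
          expandˡ = solve-∀ ℚ-ring
          expandʳ : ∀ s P T A B Qr Qe a i c →
            s * T * B * ((c + Qe * (a + Qr * i)) * P) + s * (T * Qr) * i * P * A
            ≡ s * P * T * (c * B) + s * P * T * (Qr * i * A + Qe * B * (a + Qr * i))
          expandʳ = solve-∀ ℚ-ring

      inversionTerm-telescopes : ∀ {N m} e j r → m ≡ j ℕ.+ suc r → N ≡ 2 ℕ.* m ℕ.+ e →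
        [ m ] * inversionTerm N m j ≡ certificate N m e (suc j) - certificate N m e j
      inversionTerm-telescopes e j r refl refl = GosperStep.telescopes e j r

      inversionTerm-sum≡0 : ∀ N m → 1 ≤ m → 2 ℕ.* m ≤ N → sumTo (suc m) (inversionTerm N m) ≡ 0ℚ
      inversionTerm-sum≡0 N m 1≤m 2m≤N = *-cancelʳ ([n]≢0 m 1≤m) (begin
        sumTo (suc m) t * [ m ]                                ≡⟨ ℚP.*-comm (sumTo (suc m) t) [ m ] ⟩
        [ m ] * sumTo (suc m) t                                ≡⟨ *-distribˡ-sumTo (suc m) [ m ] t ⟩
        sumTo m (λ j → [ m ] * t j) + [ m ] * t m              ≡⟨ cong (_+ [ m ] * t m) (sumTo-cong m telescopes) ⟩
        sumTo m (λ j → H (suc j) - H j) + [ m ] * t m          ≡⟨ cong (_+ [ m ] * t m) (sumTo-telescope m H) ⟩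
        H m - H 0 + [ m ] * t m                                ≡⟨ cong₂ (λ a b → endpoints a - H 0 + [ m ] * (s * P * lucasCoeff (N ∸ 2 ℕ.* m) b))
                                                                        (ℕP.n∸n≡0 m) (ℕP.n∸n≡0 m) ⟩
        endpoints 0 - H 0 + [ m ] * (s * P * 1ℚ)               ≡⟨ cancel s [ m ] P (q ^ triangular (suc m)) ((m ℕ.+ e) choose m) ⟩
        0ℚ                                                     ≡⟨ ℚP.*-zeroˡ [ m ] ⟨
        0ℚ * [ m ]                                             ∎)
        where
        e : ℕ
        e = N ∸ 2 ℕ.* m
        t H : ℕ → ℚ
        t = inversionTerm N m
        H = certificate N m e
        s P : ℚ
        s = (- 1ℚ) ^ m
        P = N choose m
        endpoints : ℕ → ℚ
        endpoints a = - (s * q ^ triangular (suc a) * [ m ] * P * ((a ℕ.+ e) choose a))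
        telescopes : ∀ j → j < m → [ m ] * t j ≡ H (suc j) - H j
        telescopes j j<m = inversionTerm-telescopes e j (m ∸ suc j)
          (sym (trans (ℕP.+-suc j (m ∸ suc j)) (ℕP.m+[n∸m]≡n j<m))) (sym (ℕP.m+[n∸m]≡n 2m≤N))
        cancel : ∀ s i P T Y → - (s * 1ℚ * i * P * 1ℚ) - - (1ℚ * T * 0ℚ * 1ℚ * Y) + i * (s * P * 1ℚ) ≡ 0ℚ
        cancel = solve-∀ ℚ-ring

      qbinom-⊖'-negative : ∀ n {i j} → i < j → qbinom q n (i ⊖' j) ≡ 0ℚ
      qbinom-⊖'-negative n {i} {j} i<j = cong (qbinom q n) (begin
        i ⊖' j                      ≡⟨ ℤP.m-n≡m⊖n i j ⟩
        i ℤ.⊖ j                     ≡⟨ ℤP.⊖-< i<j ⟩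
        ℤ.- (ℤ.+ (j ∸ i))           ≡⟨ cong (λ d → ℤ.- (ℤ.+ d)) (ℕP.+-∸-assoc 1 i<j) ⟩
        ℤ.-[1+ j ∸ suc i ]          ∎)

      qbinom-⊖' : ∀ n {i j} → j ≤ i → qbinom q n (i ⊖' j) ≡ n choose (i ∸ j)
      qbinom-⊖' n {i} {j} j≤i = trans (cong (qbinom q n) (trans (ℤP.m-n≡m⊖n i j) (ℤP.⊖-≥ j≤i))) (qbinom≡choose n (i ∸ j))

      module Lucas (x : ℚ) where

        lucas : ℕ → ℚ
        lucas N = sumTo (suc ⌊ N /2⌋) (λ k → lucasCoeff N k * x ^ (N ∸ 2 ℕ.* k))

        Luc≡lucas : ∀ N → 1 ≤ N → Luc q N x ≡ lucas N
        Luc≡lucas N@(suc N′) _ = begin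
          Luc q N x                      ≡⟨ cong (λ h → sumTo (suc h) paperTerm) (n/2≡⌊n/2⌋ N) ⟩
          sumTo (suc ⌊ N /2⌋) paperTerm  ≡⟨ sumTo-cong (suc ⌊ N /2⌋) (λ k k≤⌊N/2⌋ → cong (_* x ^ (N ∸ 2 ℕ.* k))
                                              (lucasCoeff≡ N k (ℕP.≤-<-trans (ℕP.≤-pred k≤⌊N/2⌋) (ℕP.⌊n/2⌋<n N′)))) ⟩
          lucas N                        ∎
          where
          paperTerm : ℕ → ℚ
          paperTerm k = q ^ (k C 2) * qbinom q (N ∸ k) (ℤ.+ k) * (qint q N /' qint q (N ∸ k)) * x ^ (N ∸ 2 ℕ.* k)

        lucas-small : ∀ {e} → e ≤ 1 → lucas e ≡ x ^ e
        lucas-small z≤n       = ℚP.+-identityˡ (1ℚ * 1ℚ)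
        lucas-small (s≤s z≤n) = trans (ℚP.+-identityˡ (1ℚ * x ^ 1)) (ℚP.*-identityˡ (x ^ 1))

        choose*lucas≡ : ∀ N j → (- 1ℚ) ^ j * (N choose j) * lucas (N ∸ 2 ℕ.* j)
          ≡ sumTo (suc (⌊ N /2⌋ ∸ j)) (λ k → inversionTerm N (j ℕ.+ k) j * x ^ (N ∸ 2 ℕ.* (j ℕ.+ k)))
        choose*lucas≡ N j = begin
          c * lucas (N ∸ 2 ℕ.* j)
            ≡⟨ cong (λ h → c * sumTo (suc h) (λ k → lucasCoeff (N ∸ 2 ℕ.* j) k * x ^ (N ∸ 2 ℕ.* j ∸ 2 ℕ.* k)))
                    (⌊[n∸2j]/2⌋≡⌊n/2⌋∸j N j) ⟩
          c * sumTo (suc (⌊ N /2⌋ ∸ j)) (λ k → lucasCoeff (N ∸ 2 ℕ.* j) k * x ^ (N ∸ 2 ℕ.* j ∸ 2 ℕ.* k))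
            ≡⟨ *-distribˡ-sumTo (suc (⌊ N /2⌋ ∸ j)) c _ ⟩
          sumTo (suc (⌊ N /2⌋ ∸ j)) (λ k → c * (lucasCoeff (N ∸ 2 ℕ.* j) k * x ^ (N ∸ 2 ℕ.* j ∸ 2 ℕ.* k)))
            ≡⟨ sumTo-cong (suc (⌊ N /2⌋ ∸ j)) (λ k _ → term k) ⟩
          sumTo (suc (⌊ N /2⌋ ∸ j)) (λ k → inversionTerm N (j ℕ.+ k) j * x ^ (N ∸ 2 ℕ.* (j ℕ.+ k)))
            ∎
          where
          c : ℚ
          c = (- 1ℚ) ^ j * (N choose j)
          term : ∀ k → c * (lucasCoeff (N ∸ 2 ℕ.* j) k * x ^ (N ∸ 2 ℕ.* j ∸ 2 ℕ.* k))
                       ≡ inversionTerm N (j ℕ.+ k) j * x ^ (N ∸ 2 ℕ.* (j ℕ.+ k))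
          term k = trans (sym (ℚP.*-assoc c _ _))
            (cong₂ (λ a b → c * lucasCoeff (N ∸ 2 ℕ.* j) a * x ^ b) (sym (ℕP.m+n∸m≡n j k))
                   (trans (ℕP.∸-+-assoc N (2 ℕ.* j) (2 ℕ.* k)) (cong (N ∸_) (sym (ℕP.*-distribˡ-+ 2 j k)))))

        lucas-inversion : ∀ N →
          sumTo (suc ⌊ N /2⌋) (λ j → (- 1ℚ) ^ j * (N choose j) * lucas (N ∸ 2 ℕ.* j)) ≡ x ^ N
        lucas-inversion N = begin
          sumTo (suc h) (λ j → (- 1ℚ) ^ j * (N choose j) * lucas (N ∸ 2 ℕ.* j))
            ≡⟨ sumTo-cong (suc h) (λ j _ → choose*lucas≡ N j) ⟩
          sumTo (suc h) (λ j → sumTo (suc (h ∸ j)) (λ k → g j (j ℕ.+ k)))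
            ≡⟨ sumTo-triangle h g ⟩
          sumTo (suc h) (λ m → sumTo (suc m) (λ j → g j m))
            ≡⟨ sumTo-cong (suc h) (λ m _ → sym (*-distribʳ-sumTo (suc m) (x ^ (N ∸ 2 ℕ.* m)) (inversionTerm N m))) ⟩
          sumTo (suc h) (λ m → sumTo (suc m) (inversionTerm N m) * x ^ (N ∸ 2 ℕ.* m))
            ≡⟨ sumTo-head h _ ⟩
          (0ℚ + 1ℚ * 1ℚ * 1ℚ) * x ^ N + sumTo h (λ m → sumTo (2 ℕ.+ m) (inversionTerm N (suc m)) * x ^ (N ∸ 2 ℕ.* suc m))
            ≡⟨ cong ((0ℚ + 1ℚ * 1ℚ * 1ℚ) * x ^ N +_) (sumTo-zero h vanishes) ⟩
          (0ℚ + 1ℚ * 1ℚ * 1ℚ) * x ^ N + 0ℚ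
            ≡⟨ simplify (x ^ N) ⟩
          x ^ N
            ∎
          where
          h : ℕ
          h = ⌊ N /2⌋
          g : ℕ → ℕ → ℚ
          g j m = inversionTerm N m j * x ^ (N ∸ 2 ℕ.* m)
          vanishes : ∀ m → m < h → sumTo (2 ℕ.+ m) (inversionTerm N (suc m)) * x ^ (N ∸ 2 ℕ.* suc m) ≡ 0ℚ
          vanishes m m<h = trans (cong (_* x ^ (N ∸ 2 ℕ.* suc m)) (inversionTerm-sum≡0 N (suc m) (s≤s z≤n) (k≤⌊n/2⌋⇒2k≤n N m<h)))
                                 (ℚP.*-zeroˡ (x ^ (N ∸ 2 ℕ.* suc m)))
          simplify : ∀ y → (0ℚ + 1ℚ * 1ℚ * 1ℚ) * y + 0ℚ ≡ y
          simplify = solve-∀ ℚ-ring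

        lucas-inversion-tail : ∀ M →
          lucas (2 ℕ.+ M) - sumTo (suc ⌊ M /2⌋) (λ j → (- 1ℚ) ^ j * ((2 ℕ.+ M) choose suc j) * lucas (M ∸ 2 ℕ.* j))
          ≡ x ^ (2 ℕ.+ M)
        lucas-inversion-tail M = begin
          L - sumTo (suc h) s
            ≡⟨ negate L (sumTo (suc h) s) ⟩
          1ℚ * 1ℚ * L + (- 1ℚ) * sumTo (suc h) s
            ≡⟨ cong (1ℚ * 1ℚ * L +_) (*-distribˡ-sumTo (suc h) (- 1ℚ) s) ⟩
          1ℚ * 1ℚ * L + sumTo (suc h) (λ j → (- 1ℚ) * s j)
            ≡⟨ cong (1ℚ * 1ℚ * L +_) (sumTo-cong (suc h) (λ j _ → shift j)) ⟩
          1ℚ * 1ℚ * L + sumTo (suc h) (λ j → (- 1ℚ) ^ suc j * ((2 ℕ.+ M) choose suc j) * lucas (2 ℕ.+ M ∸ 2 ℕ.* suc j))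
            ≡⟨ sumTo-head (suc h) _ ⟨
          sumTo (2 ℕ.+ h) (λ j → (- 1ℚ) ^ j * ((2 ℕ.+ M) choose j) * lucas (2 ℕ.+ M ∸ 2 ℕ.* j))
            ≡⟨ lucas-inversion (2 ℕ.+ M) ⟩
          x ^ (2 ℕ.+ M)
            ∎
          where
          h : ℕ
          h = ⌊ M /2⌋
          L : ℚ
          L = lucas (2 ℕ.+ M)
          s : ℕ → ℚ
          s j = (- 1ℚ) ^ j * ((2 ℕ.+ M) choose suc j) * lucas (M ∸ 2 ℕ.* j)
          shift : ∀ j → (- 1ℚ) * s j ≡ (- 1ℚ) ^ suc j * ((2 ℕ.+ M) choose suc j) * lucas (2 ℕ.+ M ∸ 2 ℕ.* suc j)
          shift j = trans (reassociate ((- 1ℚ) ^ j) ((2 ℕ.+ M) choose suc j) (lucas (M ∸ 2 ℕ.* j)))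
                          (cong (λ n → (- 1ℚ) ^ suc j * ((2 ℕ.+ M) choose suc j) * lucas (2 ℕ.+ M ∸ n)) (sym (2*suc j)))
            where
            reassociate : ∀ σ c l → (- 1ℚ) * (σ * c * l) ≡ (- 1ℚ) * σ * c * l
            reassociate = solve-∀ ℚ-ring
          negate : ∀ L S → L - S ≡ 1ℚ * 1ℚ * L + (- 1ℚ) * S
          negate = solve-∀ ℚ-ring

        lucas-recurrence : ∀ M → lucas (2 ℕ.+ M)
          ≡ sumTo (suc ⌊ M /2⌋) (λ j → (- 1ℚ) ^ j * ((2 ℕ.+ M) choose suc j + x ^ 2 * (M choose j)) * lucas (M ∸ 2 ℕ.* j))
        lucas-recurrence M = begin
          lucas (2 ℕ.+ M)
            ≡⟨ split (lucas (2 ℕ.+ M)) (sumTo (suc h) s) ⟩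
          (lucas (2 ℕ.+ M) - sumTo (suc h) s) + 1ℚ * sumTo (suc h) s
            ≡⟨ cong (_+ 1ℚ * sumTo (suc h) s) (trans (lucas-inversion-tail M) (^-distribˡ-+-* x 2 M)) ⟩
          x ^ 2 * x ^ M + 1ℚ * sumTo (suc h) s
            ≡⟨ cong (λ z → x ^ 2 * z + 1ℚ * sumTo (suc h) s) (lucas-inversion M) ⟨
          x ^ 2 * sumTo (suc h) t + 1ℚ * sumTo (suc h) s
            ≡⟨ sumTo-linear (suc h) (x ^ 2) 1ℚ t s ⟨
          sumTo (suc h) (λ j → x ^ 2 * t j + 1ℚ * s j)
            ≡⟨ sumTo-cong (suc h) (λ j _ → combine ((- 1ℚ) ^ j) (x ^ 2) ((2 ℕ.+ M) choose suc j) (M choose j) (lucas (M ∸ 2 ℕ.* j))) ⟩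
          sumTo (suc h) (λ j → (- 1ℚ) ^ j * ((2 ℕ.+ M) choose suc j + x ^ 2 * (M choose j)) * lucas (M ∸ 2 ℕ.* j))
            ∎
          where
          h : ℕ
          h = ⌊ M /2⌋
          s t : ℕ → ℚ
          s j = (- 1ℚ) ^ j * ((2 ℕ.+ M) choose suc j) * lucas (M ∸ 2 ℕ.* j)
          t j = (- 1ℚ) ^ j * (M choose j) * lucas (M ∸ 2 ℕ.* j)
          split : ∀ L S → L ≡ (L - S) + 1ℚ * S
          split = solve-∀ ℚ-ring
          combine : ∀ σ y b c l → y * (σ * c * l) + 1ℚ * (σ * b * l) ≡ σ * (b + y * c) * l
          combine = solve-∀ ℚ-ring

        lucas-lastRowRecurrence : ∀ (a : Matrix) {e} n → ⌊ 2 ℕ.* n ℕ.+ e /2⌋ ≡ n →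
          (∀ k → k ≤ n → a n k ≡ ((2 ℕ.* n ℕ.+ e) choose (n ∸ k)) * x ^ 2 + ((2 ℕ.+ (2 ℕ.* n ℕ.+ e)) choose (suc n ∸ k))) →
          sumTo (suc n) (λ k → (- 1ℚ) ^ (n ∸ k) * a n k * lucas (2 ℕ.* k ℕ.+ e)) ≡ lucas (2 ℕ.* suc n ℕ.+ e)
        lucas-lastRowRecurrence a {e} n ⌊M/2⌋≡n entry = begin
          sumTo (suc n) (λ k → (- 1ℚ) ^ (n ∸ k) * a n k * lucas (2 ℕ.* k ℕ.+ e))
            ≡⟨ sumTo-reverse n _ ⟩
          sumTo (suc n) (λ j → (- 1ℚ) ^ (n ∸ (n ∸ j)) * a n (n ∸ j) * lucas (2 ℕ.* (n ∸ j) ℕ.+ e))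
            ≡⟨ sumTo-cong (suc n) (λ j j<1+n → reflected j (ℕP.≤-pred j<1+n)) ⟩
          sumTo (suc n) term
            ≡⟨ cong (λ h → sumTo (suc h) term) ⌊M/2⌋≡n ⟨
          sumTo (suc ⌊ M /2⌋) term
            ≡⟨ lucas-recurrence M ⟨
          lucas (2 ℕ.+ M)
            ≡⟨ cong (λ m → lucas (m ℕ.+ e)) (2*suc n) ⟨
          lucas (2 ℕ.* suc n ℕ.+ e)
            ∎
          where
          M : ℕ
          M = 2 ℕ.* n ℕ.+ e
          term : ℕ → ℚ
          term j = (- 1ℚ) ^ j * ((2 ℕ.+ M) choose suc j + x ^ 2 * (M choose j)) * lucas (M ∸ 2 ℕ.* j)
          reflected : ∀ j → j ≤ n → (- 1ℚ) ^ (n ∸ (n ∸ j)) * a n (n ∸ j) * lucas (2 ℕ.* (n ∸ j) ℕ.+ e) ≡ term j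
          reflected j j≤n = begin
            (- 1ℚ) ^ (n ∸ (n ∸ j)) * a n (n ∸ j) * lucas (2 ℕ.* (n ∸ j) ℕ.+ e)
              ≡⟨ cong₂ (λ u v → (- 1ℚ) ^ (n ∸ (n ∸ j)) * u * lucas v) (entry (n ∸ j) (ℕP.m∸n≤m n j)) 2[n∸j]+e≡M∸2j ⟩
            (- 1ℚ) ^ (n ∸ (n ∸ j)) * ((M choose (n ∸ (n ∸ j))) * x ^ 2 + ((2 ℕ.+ M) choose (suc n ∸ (n ∸ j)))) * lucas (M ∸ 2 ℕ.* j)
              ≡⟨ cong₂ (λ u v → (- 1ℚ) ^ u * ((M choose u) * x ^ 2 + ((2 ℕ.+ M) choose v)) * lucas (M ∸ 2 ℕ.* j))
                       n∸[n∸j]≡j (trans (ℕP.+-∸-assoc 1 (ℕP.m∸n≤m n j)) (cong suc n∸[n∸j]≡j)) ⟩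
            (- 1ℚ) ^ j * ((M choose j) * x ^ 2 + ((2 ℕ.+ M) choose suc j)) * lucas (M ∸ 2 ℕ.* j)
              ≡⟨ commute ((- 1ℚ) ^ j) (M choose j) (x ^ 2) ((2 ℕ.+ M) choose suc j) (lucas (M ∸ 2 ℕ.* j)) ⟩
            term j
              ∎
            where
            n∸[n∸j]≡j : n ∸ (n ∸ j) ≡ j
            n∸[n∸j]≡j = ℕP.m∸[m∸n]≡n j≤n
            2[n∸j]+e≡M∸2j : 2 ℕ.* (n ∸ j) ℕ.+ e ≡ M ∸ 2 ℕ.* j
            2[n∸j]+e≡M∸2j = trans (cong (ℕ._+ e) (ℕP.*-distribˡ-∸ 2 n j)) (sym (ℕP.+-∸-comm e (ℕP.*-monoʳ-≤ 2 j≤n)))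
            commute : ∀ σ c y b l → σ * (c * y + b) * l ≡ σ * (b + y * c) * l
            commute = solve-∀ ℚ-ring

        x^e*leadingMinor≡lucas : ∀ {a e} → e ≤ 1 → IsUnitHessenberg a →
          (∀ n k → k ≤ n → a n k ≡ ((2 ℕ.* n ℕ.+ e) choose (n ∸ k)) * x ^ 2 + ((2 ℕ.+ (2 ℕ.* n ℕ.+ e)) choose (suc n ∸ k))) →
          ∀ n → x ^ e * leadingMinor a n ≡ lucas (2 ℕ.* n ℕ.+ e)
        x^e*leadingMinor≡lucas {a} {e} e≤1 H entry = <-rec P step
          where
          P : ℕ → Set
          P n = x ^ e * leadingMinor a n ≡ lucas (2 ℕ.* n ℕ.+ e)
          step : ∀ n → (∀ {m} → m < n → P m) → P n
          step zero    _  = trans (ℚP.*-identityʳ (x ^ e)) (sym (lucas-small e≤1))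
          step (suc n) IH = begin
            x ^ e * leadingMinor a (suc n)
              ≡⟨ cong (x ^ e *_) (leadingMinor-expandLastRow n H) ⟩
            x ^ e * sumTo (suc n) (λ k → (- 1ℚ) ^ (n ∸ k) * a n k * leadingMinor a k)
              ≡⟨ *-distribˡ-sumTo (suc n) (x ^ e) _ ⟩
            sumTo (suc n) (λ k → x ^ e * ((- 1ℚ) ^ (n ∸ k) * a n k * leadingMinor a k))
              ≡⟨ sumTo-cong (suc n) (λ k k≤n → trans (swap (x ^ e) ((- 1ℚ) ^ (n ∸ k) * a n k) (leadingMinor a k))
                                                    (cong ((- 1ℚ) ^ (n ∸ k) * a n k *_) (IH k≤n))) ⟩
            sumTo (suc n) (λ k → (- 1ℚ) ^ (n ∸ k) * a n k * lucas (2 ℕ.* k ℕ.+ e))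
              ≡⟨ lucas-lastRowRecurrence a n (⌊[2n+e]/2⌋≡n n e≤1) (entry n) ⟩
            lucas (2 ℕ.* suc n ℕ.+ e)
              ∎
            where
            swap : ∀ y c d → y * (c * d) ≡ c * (y * d)
            swap = solve-∀ ℚ-ring

        qbinomMatrix : (ℕ → ℕ) → (ℕ → ℕ) → Matrix
        qbinomMatrix t b i j = qbinom q (t i) (i ⊖' j) * x ^ 2 + qbinom q (b i) (suc i ⊖' j)

        qbinomMatrix-isUnitHessenberg : ∀ t b → IsUnitHessenberg (qbinomMatrix t b)
        qbinomMatrix-isUnitHessenberg t b = record
          { above-superdiagonal = λ i j i+1<j → begin
              qbinom q (t i) (i ⊖' j) * x ^ 2 + qbinom q (b i) (suc i ⊖' j)
                ≡⟨ cong₂ (λ u v → u * x ^ 2 + v) (qbinom-⊖'-negative (t i) (ℕP.<-trans (ℕP.n<1+n i) i+1<j))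
                                                  (qbinom-⊖'-negative (b i) i+1<j) ⟩
              0ℚ * x ^ 2 + 0ℚ
                ≡⟨ vanish (x ^ 2) ⟩
              0ℚ ∎
          ; superdiagonal = λ i → begin
              qbinom q (t i) (i ⊖' suc i) * x ^ 2 + qbinom q (b i) (suc i ⊖' suc i)
                ≡⟨ cong₂ (λ u v → u * x ^ 2 + qbinom q (b i) v) (qbinom-⊖'-negative (t i) (ℕP.n<1+n i)) (ℤP.+-inverseʳ (ℤ.+ suc i)) ⟩
              0ℚ * x ^ 2 + 1ℚ
                ≡⟨ unit (x ^ 2) ⟩
              1ℚ ∎
          }
          where
          vanish : ∀ y → 0ℚ * y + 0ℚ ≡ 0ℚ
          vanish = solve-∀ ℚ-ring
          unit : ∀ y → 0ℚ * y + 1ℚ ≡ 1ℚ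
          unit = solve-∀ ℚ-ring

        x^e*leadingMinor-qbinomMatrix≡lucas : ∀ {t b e} → e ≤ 1 → (∀ i → t i ≡ 2 ℕ.* i ℕ.+ e) → (∀ i → b i ≡ t i ℕ.+ 2) →
          ∀ n → x ^ e * leadingMinor (qbinomMatrix t b) n ≡ lucas (2 ℕ.* n ℕ.+ e)
        x^e*leadingMinor-qbinomMatrix≡lucas {t} {b} {e} e≤1 t≡ b≡ =
          x^e*leadingMinor≡lucas e≤1 (qbinomMatrix-isUnitHessenberg t b) entry
          where
          entry : ∀ n k → k ≤ n →
            qbinomMatrix t b n k ≡ ((2 ℕ.* n ℕ.+ e) choose (n ∸ k)) * x ^ 2 + ((2 ℕ.+ (2 ℕ.* n ℕ.+ e)) choose (suc n ∸ k))
          entry n k k≤n = cong₂ (λ u v → u * x ^ 2 + v)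
            (trans (qbinom-⊖' (t n) k≤n) (cong (λ m → m choose (n ∸ k)) (t≡ n)))
            (trans (qbinom-⊖' (b n) (ℕP.m≤n⇒m≤1+n k≤n))
                   (cong (λ m → m choose (suc n ∸ k)) (trans (b≡ n) (trans (cong (ℕ._+ 2) (t≡ n)) (ℕP.+-comm _ 2)))))

open import Defs
open import Data.Nat using (ℕ; suc; _*_; _+_; _≤_)
open import Data.Rational using (ℚ; 0ℚ; 1ℚ; _-_) renaming (_*_ to _*ℚ_)
open import Data.Product using (_×_)
open import Relation.Binary.PropositionalEquality using (_≡_; _≢_)

open import Data.Nat using (z≤n; s≤s)
import Data.Nat.Properties as ℕP
import Data.Rational.Properties as ℚP
open import Data.Product using (_,_)
open import Relation.Binary.PropositionalEquality using (refl; sym; cong; module ≡-Reasoning)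
open ≡-Reasoning

proposition7 : (q : ℚ) → (∀ (m : ℕ) → 1 ≤ m → 1ℚ - q ^ m ≢ 0ℚ) → (x : ℚ) →
    (∀ (n : ℕ) → 1 ≤ n → det n (Meven q x n) ≡ Luc q (2 * n) x)
    × (∀ (n : ℕ) → x *ℚ det n (Modd q x n) ≡ Luc q (2 * n + 1) x)
proposition7 q q^m≢1 x = even , odd
  where
  open Proof.Lucas q q^m≢1 x
  -- det n (Meven q x n) and det n (Modd q x n) are definitionally leading minors of qbinomMatrix
  even : ∀ n → 1 ≤ n → det n (Meven q x n) ≡ Luc q (2 * n) x
  even n 1≤n = begin
    det n (Meven q x n)             ≡⟨ ℚP.*-identityˡ _ ⟨
    x ^ 0 *ℚ det n (Meven q x n)    ≡⟨ x^e*leadingMinor-qbinomMatrix≡lucas z≤n (λ i → sym (ℕP.+-identityʳ (2 * i))) (λ _ → refl) n ⟩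
    lucas (2 * n + 0)               ≡⟨ cong lucas (ℕP.+-identityʳ (2 * n)) ⟩
    lucas (2 * n)                   ≡⟨ Luc≡lucas (2 * n) (ℕP.≤-trans 1≤n (ℕP.m≤n*m n 2)) ⟨
    Luc q (2 * n) x                 ∎
  odd : ∀ n → x *ℚ det n (Modd q x n) ≡ Luc q (2 * n + 1) x
  odd n = begin
    x *ℚ det n (Modd q x n)         ≡⟨ cong (_*ℚ det n (Modd q x n)) (ℚP.*-identityʳ x) ⟨
    x ^ 1 *ℚ det n (Modd q x n)     ≡⟨ x^e*leadingMinor-qbinomMatrix≡lucas (s≤s z≤n) (λ _ → refl) (λ i → sym (ℕP.+-assoc (2 * i) 1 2)) n ⟩
    lucas (2 * n + 1)               ≡⟨ Luc≡lucas (2 * n + 1) (ℕP.m≤n+m 1 (2 * n)) ⟨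
    Luc q (2 * n + 1) x             ∎
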